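{- For every finite sum $S$ of resource terms there exists $k\in\mathbf N$ such that $H_r^k(S)$ is in head normal form (every resource term in $H_r^k(S)$ is in head normal form).
   Context: Resource terms: $s::=x\mid\lambda x.s\mid\langle s\rangle\bar t$ with $\bar t$ a finite multiset of resource terms. A finite sum is a finite set of resource terms written additively ($0$ the empty sum); constructors extend by linearity. Resource substitution $s\langle\bar t/x\rangle$ is the sum over all ways of replacing the free occurrences of $x$ in $s$ bijectively by the elements of $\bar t$ ($0$ if the number of occurrences differs from the cardinality of $\bar t$). Every resource term can be written $s=\lambda x_1\dots\lambda x_m.\langle\dots\langle\langle u\rangle\bar t_1\rangle\dots\rangle\bar t_n$ with $u$ either a variable (then $s$ is in head normal form) or a redex $\langle\lambda z.v\rangle\bar w$ (the head redex). $H_r(s)$ is $s$ if $s$ is in head normal form, and otherwise the sum obtained from $s$ by replacing its head redex $\langle\lambda z.v\rangle\bar w$ by $v\langle\bar w/z\rangle$ (distributing by linearity). For a finite sum, $H_r(\sum_is_i)=\sum_iH_r(s_i)$, and $H_r^k$ is the $k$-fold iterate. -}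

module Defs where

open import Data.Nat using (ℕ; zero; suc; _<ᵇ_; _≡ᵇ_)
open import Data.Nat.Base using (pred)
open import Data.Bool using (Bool; true; false; if_then_else_)
open import Data.List using (List; []; _∷_; map; concatMap)
open import Data.List.Relation.Unary.All using (All)
open import Data.Product using (_×_; _,_)

-- A finite multiset (bag) of resource terms is represented by a list
-- (order irrelevant: all operations below are invariant under permutation
-- up to reordering of the resulting sums).
data Term : Set where
  var : ℕ → Term
  lam : Term → Term
  app : Term → List Term → Term

Bag : Set
Bag = List Term

-- A finite sum of resource terms; 0 is the empty list.
Sum : Set
Sum = List Term

mutual
  shift : ℕ → Term → Term
  shift c (var j) = if j <ᵇ c then var j else var (suc j)
  shift c (lam s) = lam (shift (suc c) s)
  shift c (app s ts) = app (shift c s) (shiftBag c ts)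

  shiftBag : ℕ → Bag → Bag
  shiftBag c [] = []
  shiftBag c (t ∷ ts) = shift c t ∷ shiftBag c ts

splits : Bag → List (Bag × Bag)
splits [] = ([] , []) ∷ []
splits (t ∷ ts) = concatMap (λ { (l , r) → (t ∷ l , r) ∷ (l , t ∷ r) ∷ [] }) (splits ts)

-- Resource substitution s⟨t̄/k⟩ of the bag t̄ for the variable k, where the
-- binder of k is removed (free variables above k are decremented).
-- Result: the sum over all bijections between occurrences of k and the
-- elements of t̄ (0 if the numbers differ).
mutual
  rsubst : ℕ → Term → Bag → Sum
  rsubst k (var j) bag with j ≡ᵇ k
  rsubst k (var j) (u ∷ []) | true = u ∷ []
  rsubst k (var j) _        | true = []
  rsubst k (var j) []       | false = (if j <ᵇ k then var j else var (pred j)) ∷ []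
  rsubst k (var j) (_ ∷ _)  | false = []
  rsubst k (lam s) bag = map lam (rsubst (suc k) s (shiftBag 0 bag))
  rsubst k (app s ts) bag =
    concatMap (λ { (b₁ , b₂) →
      concatMap (λ s' → map (app s') (rsubstBag k ts b₂)) (rsubst k s b₁) })
      (splits bag)

  rsubstBag : ℕ → Bag → Bag → List Bag
  rsubstBag k [] [] = [] ∷ []
  rsubstBag k [] (_ ∷ _) = []
  rsubstBag k (t ∷ ts) bag =
    concatMap (λ { (b₁ , b₂) →
      concatMap (λ t' → map (t' ∷_) (rsubstBag k ts b₂)) (rsubst k t b₁) })
      (splits bag)

data Neutral : Term → Set where
  nvar : ∀ x → Neutral (var x)
  napp : ∀ {s} ts → Neutral s → Neutral (app s ts)

data HNF : Term → Set where
  hneu : ∀ {s} → Neutral s → HNF s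
  hlam : ∀ {s} → HNF s → HNF (lam s)

Hr : Term → Sum
Hr (var x) = var x ∷ []
Hr (lam s) = map lam (Hr s)
Hr (app (var x) ts) = app (var x) ts ∷ []
Hr (app (lam v) ts) = rsubst 0 v ts
Hr (app (app s us) ts) = map (λ s' → app s' ts) (Hr (app s us))

HrSum : Sum → Sum
HrSum S = concatMap Hr S

HrIter : ℕ → Sum → Sum
HrIter zero S = S
HrIter (suc k) S = HrSum (HrIter k S)

SumHNF : Sum → Set
SumHNF S = All HNF S

{-# OPTIONS --safe #-}
-- Resource substitution is linear: every element of the substituted bag
-- replaces exactly one occurrence of the variable, so each summand of
-- v⟨t̄/x⟩ has size at most size v + size t̄.  Hence a head step strictly
-- decreases the size of every summand of a term not in head normal form,
-- while it fixes head normal forms.  Well-founded induction on size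
-- normalises a single term, and a sum normalises after the largest number of
-- steps needed by its summands, since head normal forms stay put.
module Submission where

open import Defs
open import Data.Nat using (ℕ; zero; suc; _+_; _<ᵇ_; _≡ᵇ_; _⊔_; _≤_; _<_; _≤′_; z≤n; s≤s; ≤′-refl; ≤′-step)
open import Data.Nat.Properties
  using (≤-reflexive; +-mono-≤; +-monoˡ-<; +-assoc; m≤m+n; m≤n⇒m≤1+n;
         m≤m⊔n; m≤n⊔m; ≤⇒≤′; +-commutativeSemigroup; module ≤-Reasoning)
open import Data.Nat.Induction using (<-wellFounded)
open import Algebra.Properties.CommutativeSemigroup +-commutativeSemigroup
  using (interchange; x∙yz≈y∙xz)
open import Data.Bool using (Bool; true; false; if_then_else_)
open import Data.Product using (∃; _×_; _,_)
open import Data.Sum using (_⊎_; inj₁; inj₂)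
open import Data.List using (List; []; _∷_; [_]; map; concatMap; _++_)
open import Data.List.Properties using (concatMap-++; ++-identityʳ)
open import Data.List.Relation.Unary.All as All using (All; []; _∷_)
open import Data.List.Relation.Unary.All.Properties using (++⁺; map⁺; concat⁺)
open import Function.Base using (_on_)
open import Induction.WellFounded as WF using (WellFounded)
open import Relation.Binary.Construct.On as On using ()
open import Relation.Binary.PropositionalEquality using (_≡_; refl; sym; trans; cong; cong₂; subst)

concatMap⁺ : ∀ {A B : Set} {P : B → Set} {f : A → List B} {xs : List A} →
             All (λ x → All P (f x)) xs → All P (concatMap f xs)
concatMap⁺ ps = concat⁺ (map⁺ ps)

+-mono-≤-interchange : ∀ {a b} x y {p q r} →
                       a ≤ x + p → b ≤ y + q → p + q ≡ r → a + b ≤ (x + y) + r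
+-mono-≤-interchange {a} {b} x y {p} {q} {r} a≤x+p b≤y+q p+q≡r = begin
  a + b             ≤⟨ +-mono-≤ a≤x+p b≤y+q ⟩
  (x + p) + (y + q) ≡⟨ interchange x p y q ⟩
  (x + y) + (p + q) ≡⟨ cong ((x + y) +_) p+q≡r ⟩
  (x + y) + r       ∎
  where open ≤-Reasoning

mutual
  size : Term → ℕ
  size (var _)    = 1
  size (lam s)    = suc (size s)
  size (app s ts) = suc (size s + sizeBag ts)

  sizeBag : Bag → ℕ
  sizeBag []       = 0
  sizeBag (t ∷ ts) = size t + sizeBag ts

size-if-var : ∀ (b : Bool) i j → size (if b then var i else var j) ≡ 1
size-if-var true  i j = refl
size-if-var false i j = refl

mutual
  size-shift : ∀ c t → size (shift c t) ≡ size t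
  size-shift c (var j)    = size-if-var (j <ᵇ c) j (suc j)
  size-shift c (lam s)    = cong suc (size-shift (suc c) s)
  size-shift c (app s ts) = cong suc (cong₂ _+_ (size-shift c s) (sizeBag-shiftBag c ts))

  sizeBag-shiftBag : ∀ c ts → sizeBag (shiftBag c ts) ≡ sizeBag ts
  sizeBag-shiftBag c []       = refl
  sizeBag-shiftBag c (t ∷ ts) = cong₂ _+_ (size-shift c t) (sizeBag-shiftBag c ts)

sizeSplit : Bag × Bag → ℕ
sizeSplit (l , r) = sizeBag l + sizeBag r

sizeSplit-splits : ∀ bag → All (λ lr → sizeSplit lr ≡ sizeBag bag) (splits bag)
sizeSplit-splits []       = refl ∷ []
sizeSplit-splits (t ∷ ts) = concatMap⁺ (All.map (λ { {l , r} eq →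
    trans (+-assoc (size t) (sizeBag l) (sizeBag r)) (cong (size t +_) eq) ∷
    trans (x∙yz≈y∙xz (sizeBag l) (size t) (sizeBag r)) (cong (size t +_) eq) ∷ [] })
  (sizeSplit-splits ts))

mutual
  size-rsubst : ∀ k v bag → All (λ u → size u ≤ size v + sizeBag bag) (rsubst k v bag)
  size-rsubst k (var j) bag with j ≡ᵇ k
  size-rsubst k (var j) (u ∷ [])    | true  = m≤n⇒m≤1+n (m≤m+n (size u) 0) ∷ []
  size-rsubst k (var j) []          | true  = []
  size-rsubst k (var j) (_ ∷ _ ∷ _) | true  = []
  size-rsubst k (var j) []          | false = ≤-reflexive (size-if-var (j <ᵇ k) j _) ∷ []
  size-rsubst k (var j) (_ ∷ _)     | false = []
  size-rsubst k (lam s) bag =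
    map⁺ (All.map (λ le → s≤s (subst (λ n → _ ≤ size s + n) (sizeBag-shiftBag 0 bag) le))
                  (size-rsubst (suc k) s (shiftBag 0 bag)))
  size-rsubst k (app s ts) bag =
    concatMap⁺ (All.map (λ { {b₁ , b₂} eq →
      concatMap⁺ (All.map (λ le → map⁺ (All.map (λ le′ →
        s≤s (+-mono-≤-interchange (size s) (sizeBag ts) le le′ eq)) (sizeBag-rsubstBag k ts b₂)))
        (size-rsubst k s b₁)) })
      (sizeSplit-splits bag))

  sizeBag-rsubstBag : ∀ k ts bag →
                      All (λ ts′ → sizeBag ts′ ≤ sizeBag ts + sizeBag bag) (rsubstBag k ts bag)
  sizeBag-rsubstBag k []       []      = z≤n ∷ []
  sizeBag-rsubstBag k []       (_ ∷ _) = []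
  sizeBag-rsubstBag k (t ∷ ts) bag =
    concatMap⁺ (All.map (λ { {b₁ , b₂} eq →
      concatMap⁺ (All.map (λ le → map⁺ (All.map (λ le′ →
        +-mono-≤-interchange (size t) (sizeBag ts) le le′ eq) (sizeBag-rsubstBag k ts b₂)))
        (size-rsubst k t b₁)) })
      (sizeSplit-splits bag))

_⊏_ : Term → Term → Set
_⊏_ = _<_ on size

⊏-wellFounded : WellFounded _⊏_
⊏-wellFounded = On.wellFounded size <-wellFounded

HNF⊎Hr-decreasing : ∀ s → HNF s ⊎ All (_⊏ s) (Hr s)
HNF⊎Hr-decreasing (var x) = inj₁ (hneu (nvar x))
HNF⊎Hr-decreasing (lam s) with HNF⊎Hr-decreasing s
... | inj₁ h  = inj₁ (hlam h)
... | inj₂ ds = inj₂ (map⁺ (All.map s≤s ds))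
HNF⊎Hr-decreasing (app (var x) ts) = inj₁ (hneu (napp ts (nvar x)))
HNF⊎Hr-decreasing (app (lam v) ts) = inj₂ (All.map (λ le → s≤s (m≤n⇒m≤1+n le)) (size-rsubst 0 v ts))
HNF⊎Hr-decreasing (app (app s us) ts) with HNF⊎Hr-decreasing (app s us)
... | inj₁ (hneu n) = inj₁ (hneu (napp ts n))
... | inj₂ ds       = inj₂ (map⁺ (All.map (λ lt → s≤s (+-monoˡ-< (sizeBag ts) lt)) ds))

Hr-Neutral : ∀ {s} → Neutral s → Hr s ≡ [ s ]
Hr-Neutral (nvar x)                = refl
Hr-Neutral (napp ts (nvar x))      = refl
Hr-Neutral (napp ts (napp us n)) = cong (map (λ s′ → app s′ ts)) (Hr-Neutral (napp us n))

Hr-HNF : ∀ {s} → HNF s → Hr s ≡ [ s ]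
Hr-HNF (hneu n) = Hr-Neutral n
Hr-HNF (hlam h) = cong (map lam) (Hr-HNF h)

SumHNF-HrSum : ∀ {S} → SumHNF S → SumHNF (HrSum S)
SumHNF-HrSum []                   = []
SumHNF-HrSum {s ∷ S} (h ∷ hs) rewrite Hr-HNF h = h ∷ SumHNF-HrSum hs

SumHNF-HrIter-mono : ∀ {k m S} → k ≤′ m → SumHNF (HrIter k S) → SumHNF (HrIter m S)
SumHNF-HrIter-mono ≤′-refl      h = h
SumHNF-HrIter-mono (≤′-step k≤m) h = SumHNF-HrSum (SumHNF-HrIter-mono k≤m h)

HrIter-suc : ∀ k S → HrIter (suc k) S ≡ HrIter k (HrSum S)
HrIter-suc zero    S = refl
HrIter-suc (suc k) S = cong HrSum (HrIter-suc k S)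

HrIter-++ : ∀ k A B → HrIter k (A ++ B) ≡ HrIter k A ++ HrIter k B
HrIter-++ zero    A B = refl
HrIter-++ (suc k) A B = trans (cong HrSum (HrIter-++ k A B)) (concatMap-++ Hr (HrIter k A) (HrIter k B))

HeadNormalisable : Sum → Set
HeadNormalisable S = ∃ λ k → SumHNF (HrIter k S)

headNormalisable-++ : ∀ {A B} → HeadNormalisable A → HeadNormalisable B → HeadNormalisable (A ++ B)
headNormalisable-++ {A} {B} (ka , ha) (kb , hb) =
  ka ⊔ kb ,
  subst SumHNF (sym (HrIter-++ (ka ⊔ kb) A B))
    (++⁺ (SumHNF-HrIter-mono (≤⇒≤′ (m≤m⊔n ka kb)) ha)
         (SumHNF-HrIter-mono (≤⇒≤′ (m≤n⊔m ka kb)) hb))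

headNormalisable-sum : ∀ {S} → All (λ s → HeadNormalisable [ s ]) S → HeadNormalisable S
headNormalisable-sum []       = 0 , []
headNormalisable-sum (h ∷ hs) = headNormalisable-++ h (headNormalisable-sum hs)

headNormalisable-Hr : ∀ s → HeadNormalisable (Hr s) → HeadNormalisable [ s ]
headNormalisable-Hr s (k , h) =
  suc k , subst SumHNF (sym (trans (HrIter-suc k [ s ]) (cong (HrIter k) (++-identityʳ (Hr s))))) h

headNormalisable-term : ∀ s → HeadNormalisable [ s ]
headNormalisable-term = WF.All.wfRec ⊏-wellFounded _ (λ s → HeadNormalisable [ s ]) step
  where
  step : ∀ s → (∀ {u} → u ⊏ s → HeadNormalisable [ u ]) → HeadNormalisable [ s ]
  step s ih with HNF⊎Hr-decreasing s
  ... | inj₁ h  = 0 , h ∷ []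
  ... | inj₂ ds = headNormalisable-Hr s (headNormalisable-sum (All.map ih ds))

lemma5p5 : (S : Sum) → ∃ λ (k : ℕ) → SumHNF (HrIter k S)
lemma5p5 S = headNormalisable-sum (All.universal headNormalisable-term S)
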